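{- In the graceful game, Bob has a winning strategy on every complete bipartite graph $K_{p,q}$ with $p,q\geq 2$ (no matter who starts). Alice has a winning strategy on every star $K_{1,q}$ if she is the first player.
   Context: $K_{p,q}$ is the complete bipartite graph with parts of sizes $p$ and $q$; it has $pq$ edges. A graceful labeling of a graph $G$ with $m$ edges is an injective map $f\colon V(G)\to\{0,1,\dots,m\}$ such that the induced edge labels $|f(u)-f(v)|$, $uv\in E(G)$, are pairwise distinct. The graceful game on a simple graph $G$ with $m$ edges: two players, Alice and Bob, alternately choose a free (not yet labeled) vertex and assign to it a label from $\{0,1,\dots,m\}$ not yet used. An edge both of whose endpoints are labeled gets label $|f(u)-f(v)|$; a move is legal only if after it all edge labels are pairwise distinct. Alice wins if the whole graph ends up gracefully labeled; Bob wins if he can prevent this. Either player may be the first to move. -}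

module Defs where

open import Data.Nat using (ℕ; _≤_; ∣_-_∣; _*_)
open import Data.Fin using (Fin)
open import Data.Fin.Properties as FinP using ()
open import Data.Maybe using (Maybe; just; nothing)
open import Data.Product using (Σ; ∃; _×_; _,_; proj₁; proj₂)
open import Data.Sum using (_⊎_; inj₁; inj₂)
open import Data.Sum.Properties using (≡-dec)
open import Data.Empty using (⊥)
open import Relation.Nullary using (¬_; yes; no)
open import Relation.Binary.Definitions using (DecidableEquality)
open import Relation.Binary.PropositionalEquality using (_≡_)

record Graph : Set₁ where
  field
    V         : Set
    _≟V_      : DecidableEquality V
    E         : Set
    endpoints : E → V × V
    m         : ℕ          -- number of edges; labels range over {0,…,m}

K : ℕ → ℕ → Graph
K p q = record
  { V         = Fin p ⊎ Fin q
  ; _≟V_      = ≡-dec FinP._≟_ FinP._≟_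
  ; E         = Fin p × Fin q
  ; endpoints = λ e → inj₁ (proj₁ e) , inj₂ (proj₂ e)
  ; m         = p * q
  }

module GracefulGame (G : Graph) where
  open Graph G

  -- partial labeling: nothing = free vertex
  Labeling : Set
  Labeling = V → Maybe ℕ

  empty : Labeling
  empty _ = nothing

  update : Labeling → V → ℕ → Labeling
  update f v l w with w ≟V v
  ... | yes _ = just l
  ... | no  _ = f w

  edgeLabel : Labeling → E → Maybe ℕ
  edgeLabel f e with f (proj₁ (endpoints e)) | f (proj₂ (endpoints e))
  ... | just a  | just b = just ∣ a - b ∣
  ... | _       | _      = nothing

  Valid : Labeling → Set
  Valid f = (∀ v l → f v ≡ just l → l ≤ m)
          × (∀ u v l → f u ≡ just l → f v ≡ just l → u ≡ v)
          × (∀ e e' d → edgeLabel f e ≡ just d → edgeLabel f e' ≡ just d → e ≡ e')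

  Legal : Labeling → V → ℕ → Set
  Legal f v l = (f v ≡ nothing) × Valid (update f v l)

  NoMove : Labeling → Set
  NoMove f = ∀ v l → ¬ Legal f v l

  Complete : Labeling → Set
  Complete f = ∀ v → ∃ λ l → f v ≡ just l

  -- Game: players alternate; the game ends when the graph is completely
  -- labeled (Alice wins) or the player to move has no legal move (Bob wins).
  -- "A" = Alice to move, "B" = Bob to move.
  mutual
    data AliceWinsA (f : Labeling) : Set where
      done : Complete f → AliceWinsA f
      move : ∀ v l → Legal f v l → AliceWinsB (update f v l) → AliceWinsA f

    data AliceWinsB (f : Labeling) : Set where
      done  : Complete f → AliceWinsB f
      reply : (Σ V λ v → Σ ℕ λ l → Legal f v l)
            → (∀ v l → Legal f v l → AliceWinsA (update f v l))
            → AliceWinsB f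

  mutual
    data BobWinsA (f : Labeling) : Set where
      reply : ¬ Complete f
            → (∀ v l → Legal f v l → BobWinsB (update f v l))
            → BobWinsA f

    data BobWinsB (f : Labeling) : Set where
      stuck : ¬ Complete f → NoMove f → BobWinsB f
      move  : ¬ Complete f → ∀ v l → Legal f v l → BobWinsA (update f v l) → BobWinsB f

AliceWinsFirst : Graph → Set
AliceWinsFirst G = GracefulGame.AliceWinsA G (GracefulGame.empty G)

BobWinsAliceFirst : Graph → Set
BobWinsAliceFirst G = GracefulGame.BobWinsA G (GracefulGame.empty G)

BobWinsBobFirst : Graph → Set
BobWinsBobFirst G = GracefulGame.BobWinsB G (GracefulGame.empty G)

module Submission where

-- Alice labels the centre 0.  Afterwards every edge label equals the
-- label of its leaf, so any unused label is a legal move, and by pigeonhole one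
-- of 1, …, q is unused while a leaf is free; the game ends fully labelled.
--
-- In a complete graceful labelling the largest label m = pq sits on an
-- edge, so 0 and m label the two ends of an edge (Extremes.extremeEdge).  This
-- makes a position dead, i.e. without complete valid extension, in four
-- situations: 0 and m on one side; nonzero α, β with α + β = m on opposite
-- sides; a full side avoiding 0 and m; 1 and m − 1 on one side and 2 on the
-- other.  From a dead position Bob wins by just playing on (Board.dead⇒BobWinsA).
-- Bob reaches such a position within his first two moves.  Against an opening
-- x ≠ m/2 he completes one of the first two patterns at once; after the opening
-- m/2, and when he starts himself, he plays 1 and relies on a common threat
-- (BobWins.Threat) whose legality conditions are the arithmetic facts proved
-- just before it.

open import Defs
open import Data.Nat using (ℕ; zero; suc; _+_; _*_; _∸_; _≤_; _<_; z≤n; s≤s; s≤s⁻¹; ∣_-_∣; _≟_; _≤?_)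
open import Data.Nat.Properties
open import Data.Nat.Tactic.RingSolver using (solve-∀)
open import Data.Fin using (Fin; zero; suc; toℕ; fromℕ<; remQuot; combine)
import Data.Fin.Properties as FinP
open import Data.Maybe using (Maybe; just; nothing)
open import Data.Maybe.Properties as MaybeP using (just-injective)
open import Data.Product using (Σ; ∃; _×_; _,_; proj₁; proj₂; swap)
import Data.Product.Properties as ProdP
open import Data.Sum as Sum using (_⊎_; inj₁; inj₂; [_,_])
open import Data.Bool using (Bool; true; false; not)
open import Data.Bool.Properties using (not-¬)
open import Data.Empty using (⊥; ⊥-elim)
open import Data.List using (List; []; _∷_; length; lookup; map; _++_; allFin)
open import Data.List.Membership.Propositional using (_∈_)
open import Data.List.Membership.Propositional.Properties using (∈-map⁺; ∈-++⁺ˡ; ∈-++⁺ʳ; ∈-allFin; ∈-lookup)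
open import Data.List.Relation.Unary.Any as Any using (Any; here; there)
open import Data.List.Relation.Unary.All as All using (All; []; _∷_)
open import Data.List.Relation.Unary.AllPairs as AllPairs using (AllPairs; []; _∷_)
open import Relation.Nullary using (¬_; ¬?; Dec; yes; no)
open import Relation.Binary.PropositionalEquality hiding ([_])
open import Function using (_∋_; _∘_)

∣-∣-split : ∀ a b c → ∣ a - b ∣ ≡ c → a ≡ b + c ⊎ b ≡ a + c
∣-∣-split zero    b       c e = inj₂ e
∣-∣-split (suc a) zero    c e = inj₁ e
∣-∣-split (suc a) (suc b) c e = Sum.map (cong suc) (cong suc) (∣-∣-split a b c e)

∣-∣-join : ∀ a b c → a ≡ b + c ⊎ b ≡ a + c → ∣ a - b ∣ ≡ c
∣-∣-join _ b c (inj₁ refl) = trans (∣-∣-comm (b + c) b) (∣m-m+n∣≡n b c)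
∣-∣-join a _ c (inj₂ refl) = ∣m-m+n∣≡n a c

∣-∣-cross : ∀ a b c d → ∣ a - b ∣ ≡ ∣ c - d ∣ → a + d ≡ b + c ⊎ a + c ≡ b + d
∣-∣-cross a b c d e = cross (∣-∣-split a b _ e) (∣-∣-split c d _ refl)
  where
  cross : ∀ {t} → a ≡ b + t ⊎ b ≡ a + t → c ≡ d + t ⊎ d ≡ c + t → a + d ≡ b + c ⊎ a + c ≡ b + d
  cross (inj₁ refl) (inj₁ refl) = inj₁ (l b _ d)
    where l : ∀ b t d → b + t + d ≡ b + (d + t)
          l = solve-∀
  cross (inj₁ refl) (inj₂ refl) = inj₂ (l b _ c)
    where l : ∀ b t c → b + t + c ≡ b + (c + t)
          l = solve-∀
  cross (inj₂ refl) (inj₁ refl) = inj₂ (l a _ d)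
    where l : ∀ a t d → a + (d + t) ≡ a + t + d
          l = solve-∀
  cross (inj₂ refl) (inj₂ refl) = inj₁ (l a _ c)
    where l : ∀ a t c → a + (c + t) ≡ a + t + c
          l = solve-∀

∣-∣-≢ : ∀ a b c d → a + d ≢ b + c → a + c ≢ b + d → ∣ a - b ∣ ≢ ∣ c - d ∣
∣-∣-≢ a b c d h₁ h₂ e = [ h₁ , h₂ ] (∣-∣-cross a b c d e)

beyond≢ : ∀ {a b} w → a ≡ b + suc w → a ≢ b
beyond≢ {b = b} w refl = m+1+n≢m b

beyond≰ : ∀ {a b} w → a ≡ b + suc w → ¬ a ≤ b
beyond≰ {b = b} w refl = m+1+n≰m b

∣-∣-extremes : ∀ {a b M} → ∣ a - b ∣ ≡ M → a ≤ M → b ≤ M → (a ≡ 0 × b ≡ M) ⊎ (a ≡ M × b ≡ 0)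
∣-∣-extremes {a} {b} {M} e a≤M b≤M with ∣-∣-split a b M e
... | inj₁ refl = let b≡0 = n≤0⇒n≡0 (+-cancelʳ-≤ M b 0 a≤M) in inj₂ (cong (_+ M) b≡0 , b≡0)
... | inj₂ refl = let a≡0 = n≤0⇒n≡0 (+-cancelʳ-≤ M a 0 b≤M) in inj₁ (a≡0 , cong (_+ M) a≡0)

∣-∣-pos : ∀ {a b} → a ≢ b → 1 ≤ ∣ a - b ∣
∣-∣-pos a≢b = n≢0⇒n>0 (λ e → a≢b (∣m-n∣≡0⇒m≡n e))

distinct-hitsTop : ∀ N (L : Fin N → ℕ) → (∀ {k k′} → L k ≡ L k′ → k ≡ k′) →
                   (∀ k → 1 ≤ L k) → (∀ k → L k ≤ N) → 1 ≤ N → ∃ λ k → L k ≡ N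
distinct-hitsTop (suc n) L inj pos bound _ with FinP.any? (λ k → L k ≟ suc n)
... | yes hit = hit
... | no miss = ⊥-elim (1+n≰n (FinP.injective⇒≤ {f = shift} shift-injective))
  where
  below : ∀ k → L k ∸ 1 < n
  below k with L k | pos k | bound k | (λ e → miss (k , e))
  ... | suc t | _ | L≤ | L≢ = s≤s⁻¹ (≤∧≢⇒< L≤ L≢)
  shift : Fin (suc n) → Fin n
  shift k = fromℕ< (below k)
  shift-injective : ∀ {k k′} → shift k ≡ shift k′ → k ≡ k′
  shift-injective {k} {k′} e = inj (∸-cancelʳ-≡ (pos k) (pos k′)
    (trans (sym (FinP.toℕ-fromℕ< (below k))) (trans (cong toℕ e) (FinP.toℕ-fromℕ< (below k′)))))

fin-first : ∀ {k} → 2 ≤ k → Fin k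
fin-first (s≤s _) = zero

fin-other : ∀ {k} → 2 ≤ k → Fin k → Fin k
fin-other (s≤s (s≤s _)) zero = suc zero
fin-other (s≤s (s≤s _)) (suc _) = zero

fin-other≢ : ∀ {k} (h : 2 ≤ k) i → fin-other h i ≢ i
fin-other≢ (s≤s (s≤s _)) zero ()
fin-other≢ (s≤s (s≤s _)) (suc _) ()

distinct-length≤ : ∀ {k} (ts : List (Fin k)) → AllPairs _≢_ ts → length ts ≤ k
distinct-length≤ ts distinct = FinP.injective⇒≤ {f = lookup ts} (lookup-injective distinct)
  where
  lookup-injective : ∀ {ts} → AllPairs _≢_ ts → ∀ {a b} → lookup ts a ≡ lookup ts b → a ≡ b
  lookup-injective (_ ∷ _) {zero} {zero} _ = refl
  lookup-injective (h ∷ _) {zero} {suc b} e = ⊥-elim (All.lookup h (∈-lookup b) e)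
  lookup-injective (h ∷ _) {suc a} {zero} e = ⊥-elim (All.lookup h (∈-lookup a) (sym e))
  lookup-injective (_ ∷ t) {suc a} {suc b} e = cong suc (lookup-injective t e)

allPairs-∈ : ∀ {A : Set} {R : A → A → Set} {xs x y} → AllPairs R xs → x ∈ xs → y ∈ xs →
             x ≡ y ⊎ R x y ⊎ R y x
allPairs-∈ (_ ∷ _)  (here refl) (here refl) = inj₁ refl
allPairs-∈ (rs ∷ _) (here refl) (there y∈) = inj₂ (inj₁ (All.lookup rs y∈))
allPairs-∈ (rs ∷ _) (there x∈) (here refl) = inj₂ (inj₂ (All.lookup rs x∈))
allPairs-∈ (_ ∷ ps) (there x∈) (there y∈) = allPairs-∈ ps x∈ y∈

module Board (p q : ℕ) where
  open GracefulGame (K p q) public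

  V : Set
  V = Fin p ⊎ Fin q

  m : ℕ
  m = p * q

  _≟V_ : (u v : V) → Dec (u ≡ v)
  _≟V_ = Graph._≟V_ (K p q)

  side : V → Bool
  side (inj₁ _) = true
  side (inj₂ _) = false

  Adj : V → V → Set
  Adj u v = side u ≢ side v

  size : Bool → ℕ
  size true = p
  size false = q

  vertexAt : (s : Bool) → Fin (size s) → V
  vertexAt true = inj₁
  vertexAt false = inj₂

  side-vertexAt : ∀ s i → side (vertexAt s i) ≡ s
  side-vertexAt true _ = refl
  side-vertexAt false _ = refl

  vertexAt-injective : ∀ s {i j} → vertexAt s i ≡ vertexAt s j → i ≡ j
  vertexAt-injective true refl = refl
  vertexAt-injective false refl = refl

  vertexAt-opposite : ∀ s {i j} → vertexAt s i ≢ vertexAt (not s) j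
  vertexAt-opposite true ()
  vertexAt-opposite false ()

  vertexAt-cases : ∀ s v → (Σ (Fin (size s)) λ i → v ≡ vertexAt s i)
                          ⊎ (Σ (Fin (size (not s))) λ j → v ≡ vertexAt (not s) j)
  vertexAt-cases true (inj₁ i) = inj₁ (i , refl)
  vertexAt-cases true (inj₂ j) = inj₂ (j , refl)
  vertexAt-cases false (inj₁ i) = inj₂ (i , refl)
  vertexAt-cases false (inj₂ j) = inj₁ (j , refl)

  nothing≢just : ∀ {k : ℕ} → (Maybe ℕ ∋ nothing) ≢ just k
  nothing≢just ()

  update-same : ∀ f v l → update f v l v ≡ just l
  update-same f v l with v ≟V v
  ... | yes _ = refl
  ... | no v≢v = ⊥-elim (v≢v refl)

  update-cases : ∀ f v l w k → update f v l w ≡ just k → (w ≡ v × l ≡ k) ⊎ (w ≢ v × f w ≡ just k)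
  update-cases f v l w k e with w ≟V v
  ... | yes w≡v = inj₁ (w≡v , just-injective e)
  ... | no w≢v = inj₂ (w≢v , e)

  update-free : ∀ f v l w → update f v l w ≡ nothing → f w ≡ nothing
  update-free f v l w e with w ≟V v
  ... | yes _ = ⊥-elim (nothing≢just (sym e))
  ... | no _ = e

  _⊑_ : Labeling → Labeling → Set
  f ⊑ g = ∀ v l → f v ≡ just l → g v ≡ just l

  ⊑-trans : ∀ {f g h} → f ⊑ g → g ⊑ h → f ⊑ h
  ⊑-trans f⊑g g⊑h v l e = g⊑h v l (f⊑g v l e)

  update-extends : ∀ f v l → f v ≡ nothing → f ⊑ update f v l
  update-extends f v l fv w k e with w ≟V v
  ... | yes refl = ⊥-elim (nothing≢just (trans (sym fv) e))
  ... | no _ = e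

  edgeLabel-intro : ∀ f i j {a b} → f (inj₁ i) ≡ just a → f (inj₂ j) ≡ just b →
                    edgeLabel f (i , j) ≡ just ∣ a - b ∣
  edgeLabel-intro f i j ea eb rewrite ea | eb = refl

  edgeLabel-elim : ∀ f i j d → edgeLabel f (i , j) ≡ just d →
                   Σ ℕ λ a → Σ ℕ λ b → f (inj₁ i) ≡ just a × f (inj₂ j) ≡ just b × ∣ a - b ∣ ≡ d
  edgeLabel-elim f i j d e with f (inj₁ i) | f (inj₂ j)
  ... | just a  | just b  = a , b , refl , refl , just-injective e
  ... | just _  | nothing = ⊥-elim (nothing≢just e)
  ... | nothing | _       = ⊥-elim (nothing≢just e)

  valid-bound : ∀ {g} → Valid g → ∀ {v l} → g v ≡ just l → l ≤ m
  valid-bound (bound , _ , _) = bound _ _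

  valid-injective : ∀ {g} → Valid g → ∀ {u v l} → g u ≡ just l → g v ≡ just l → u ≡ v
  valid-injective (_ , inj , _) = inj _ _ _

  valid-edges : ∀ {g} → Valid g → ∀ {i j i′ j′ a b a′ b′} →
                g (inj₁ i) ≡ just a → g (inj₂ j) ≡ just b → g (inj₁ i′) ≡ just a′ → g (inj₂ j′) ≡ just b′ →
                ∣ a - b ∣ ≡ ∣ a′ - b′ ∣ → i ≡ i′ × j ≡ j′
  valid-edges {g} (_ , _ , edges) {i} {j} {i′} {j′} e₁ e₂ e₃ e₄ eq =
    ProdP.,-injective (edges _ _ _ (edgeLabel-intro g i j e₁ e₂)
                                  (trans (edgeLabel-intro g i′ j′ e₃ e₄) (cong just (sym eq))))

  valid-edgesAt : ∀ {g} → Valid g → ∀ s {i j i′ j′ a b a′ b′} →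
                  g (vertexAt s i) ≡ just a → g (vertexAt (not s) j) ≡ just b →
                  g (vertexAt s i′) ≡ just a′ → g (vertexAt (not s) j′) ≡ just b′ →
                  ∣ a - b ∣ ≡ ∣ a′ - b′ ∣ → i ≡ i′ × j ≡ j′
  valid-edgesAt valid true = valid-edges valid
  valid-edgesAt valid false {a = a} {b} {a′} {b′} e₁ e₂ e₃ e₄ eq =
    swap (valid-edges valid e₂ e₁ e₄ e₃ (trans (∣-∣-comm b a) (trans eq (∣-∣-comm a′ b′))))

  valid-empty : Valid empty
  valid-empty = (λ _ _ ()) , (λ _ _ _ ()) , λ { (i , j) _ _ () }

  private
    Joins : V → V → Fin p × Fin q → Set
    Joins v u (i , j) = (inj₁ i ≡ v × inj₂ j ≡ u) ⊎ (inj₂ j ≡ v × inj₁ i ≡ u)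

    joins-unique : ∀ {v u e e′} → Joins v u e → Joins v u e′ → e ≡ e′
    joins-unique (inj₁ (refl , refl)) (inj₁ (refl , refl)) = refl
    joins-unique (inj₁ (refl , refl)) (inj₂ (() , _))
    joins-unique (inj₂ (refl , refl)) (inj₁ (() , _))
    joins-unique (inj₂ (refl , refl)) (inj₂ (refl , refl)) = refl

    NewEdge : Labeling → V → ℕ → Fin p × Fin q → ℕ → Set
    NewEdge f v l e d = edgeLabel f e ≡ just d ⊎
      (Σ V λ u → Σ ℕ λ k → f u ≡ just k × Adj u v × ∣ l - k ∣ ≡ d × Joins v u e)

    newEdge : ∀ f v l i j d → edgeLabel (update f v l) (i , j) ≡ just d → NewEdge f v l (i , j) d
    newEdge f v l i j d e with edgeLabel-elim (update f v l) i j d e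
    ... | a , b , ea , eb , ed with update-cases f v l (inj₁ i) a ea | update-cases f v l (inj₂ j) b eb
    ... | inj₁ (refl , _) | inj₁ (() , _)
    ... | inj₁ (refl , refl) | inj₂ (_ , fb) = inj₂ (inj₂ j , b , fb , (λ ()) , ed , inj₁ (refl , refl))
    ... | inj₂ (_ , fa) | inj₁ (refl , refl) =
          inj₂ (inj₁ i , a , fa , (λ ()) , trans (∣-∣-comm l a) ed , inj₂ (refl , refl))
    ... | inj₂ (_ , fa) | inj₂ (_ , fb) =
          inj₁ (subst (λ t → edgeLabel f (i , j) ≡ just t) ed (edgeLabel-intro f i j fa fb))

  legal-intro : ∀ f v l → Valid f → f v ≡ nothing → l ≤ m
    → (∀ u k → f u ≡ just k → k ≢ l)
    → (∀ e d → edgeLabel f e ≡ just d → ∀ u k → f u ≡ just k → Adj u v → ∣ l - k ∣ ≢ d)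
    → (∀ u u′ k k′ → f u ≡ just k → f u′ ≡ just k′ → Adj u v → Adj u′ v → ∣ l - k ∣ ≡ ∣ l - k′ ∣ → u ≡ u′)
    → Legal f v l
  legal-intro f v l (bound , inj , edges) fv l≤m fresh old new = fv , bound′ , inj′ , edges′
    where
    bound′ : ∀ w k → update f v l w ≡ just k → k ≤ m
    bound′ w k e with update-cases f v l w k e
    ... | inj₁ (_ , refl) = l≤m
    ... | inj₂ (_ , fw) = bound w k fw
    inj′ : ∀ u w k → update f v l u ≡ just k → update f v l w ≡ just k → u ≡ w
    inj′ u w k eu ew with update-cases f v l u k eu | update-cases f v l w k ew
    ... | inj₁ (refl , _) | inj₁ (refl , _) = refl
    ... | inj₁ (_ , refl) | inj₂ (_ , fw) = ⊥-elim (fresh w l fw refl)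
    ... | inj₂ (_ , fu) | inj₁ (_ , refl) = ⊥-elim (fresh u l fu refl)
    ... | inj₂ (_ , fu) | inj₂ (_ , fw) = inj u w k fu fw
    edges′ : ∀ e e′ d → edgeLabel (update f v l) e ≡ just d → edgeLabel (update f v l) e′ ≡ just d → e ≡ e′
    edges′ (i , j) (i′ , j′) d ee ee′ with newEdge f v l i j d ee | newEdge f v l i′ j′ d ee′
    ... | inj₁ o | inj₁ o′ = edges (i , j) (i′ , j′) d o o′
    ... | inj₁ o | inj₂ (u , k , fu , adj , eq , _) = ⊥-elim (old (i , j) d o u k fu adj eq)
    ... | inj₂ (u , k , fu , adj , eq , _) | inj₁ o = ⊥-elim (old (i′ , j′) d o u k fu adj eq)
    ... | inj₂ (u , k , fu , adj , eq , js) | inj₂ (u′ , k′ , fu′ , adj′ , eq′ , js′)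
        with new u u′ k k′ fu fu′ adj adj′ (trans eq (sym eq′))
    ... | refl = joins-unique js js′

  -- Positions reached in play, given by their placements, most recent first.
  place : List (V × ℕ) → Labeling
  place [] = empty
  place ((v , l) ∷ ps) = update (place ps) v l

  place-support : ∀ ps {u k} → place ps u ≡ just k → (u , k) ∈ ps
  place-support [] ()
  place-support ((v , l) ∷ ps) {u} {k} e with update-cases (place ps) v l u k e
  ... | inj₁ (refl , refl) = here refl
  ... | inj₂ (_ , e′) = there (place-support ps e′)

  place-free : ∀ ps {v} → All (λ (u , _) → u ≢ v) ps → place ps v ≡ nothing
  place-free ps {v} others with place ps v in e
  ... | nothing = refl
  ... | just k = ⊥-elim (All.lookup others (place-support ps e) refl)

  legal-place : ∀ ps v l → Valid (place ps) → place ps v ≡ nothing → l ≤ m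
    → All (λ (_ , k) → k ≢ l) ps
    → (∀ e d → edgeLabel (place ps) e ≡ just d → All (λ (u , k) → Adj u v → ∣ l - k ∣ ≢ d) ps)
    → AllPairs (λ (u , k) (u′ , k′) → Adj u v → Adj u′ v → ∣ l - k ∣ ≢ ∣ l - k′ ∣) ps
    → Legal (place ps) v l
  legal-place ps v l valid fv l≤m fresh old new =
    legal-intro (place ps) v l valid fv l≤m
      (λ u k fu → All.lookup fresh (place-support ps fu))
      (λ e d ed u k fu → All.lookup (old e d ed) (place-support ps fu))
      distinct
    where
    distinct : ∀ u u′ k k′ → place ps u ≡ just k → place ps u′ ≡ just k′ → Adj u v → Adj u′ v →
               ∣ l - k ∣ ≡ ∣ l - k′ ∣ → u ≡ u′
    distinct u u′ k k′ fu fu′ adj adj′ eq with allPairs-∈ new (place-support ps fu) (place-support ps fu′)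
    ... | inj₁ refl = refl
    ... | inj₂ (inj₁ r) = ⊥-elim (r adj adj′ eq)
    ... | inj₂ (inj₂ r) = ⊥-elim (r adj′ adj (sym eq))

  oneSided-noEdge : ∀ ps s → All (λ (u , _) → side u ≡ s) ps →
                    ∀ e d → edgeLabel (place ps) e ≡ just d → ⊥
  oneSided-noEdge ps s sides (i , j) d e with edgeLabel-elim (place ps) i j d e
  ... | _ , _ , ea , eb , _
      with trans (All.lookup sides (place-support ps ea)) (sym (All.lookup sides (place-support ps eb)))
  ... | ()

  starEdge : ∀ ps s v l → All (λ (u , _) → side u ≡ s) ps →
             ∀ e d → edgeLabel (place ((v , l) ∷ ps)) e ≡ just d → Any (λ (_ , k) → ∣ k - l ∣ ≡ d) ps
  starEdge ps s v l sides (i , j) d e with edgeLabel-elim (place ((v , l) ∷ ps)) i j d e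
  ... | a , b , ea , eb , ed with place-support ((v , l) ∷ ps) {inj₁ i} ea | place-support ((v , l) ∷ ps) {inj₂ j} eb
  ... | here refl | here ()
  ... | here refl | there b∈ = Any.map (λ { refl → trans (∣-∣-comm b a) ed }) b∈
  ... | there a∈ | here refl = Any.map (λ { refl → ed }) a∈
  ... | there a∈ | there b∈ with trans (All.lookup sides a∈) (sym (All.lookup sides b∈))
  ... | ()

  opposite-side : ∀ s j → side (vertexAt (not s) j) ≢ s
  opposite-side s j e = not-¬ refl (sym (trans (sym (side-vertexAt (not s) j)) e))

  oneSided-free : ∀ ps s → All (λ (u , _) → side u ≡ s) ps → ∀ {v} → side v ≢ s → place ps v ≡ nothing
  oneSided-free ps s sides v∉s = place-free ps (All.map (λ su e → v∉s (trans (cong side (sym e)) su)) sides)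

  free≢labelled : ∀ {f : Labeling} {v u k} → f v ≡ nothing → f u ≡ just k → v ≢ u
  free≢labelled fv fu refl = nothing≢just (trans (sym fv) fu)

  legal-newLabel : ∀ {f w z u k} → Legal f w z → f u ≡ just k → z ≢ k
  legal-newLabel {f} {w} {z} {u} lg fu refl =
    free≢labelled (proj₁ lg) fu
      (valid-injective (proj₂ lg) {w} {u} (update-same f w z) (update-extends f w z (proj₁ lg) u z fu))

  free? : (x : Maybe ℕ) → Dec (x ≡ nothing)
  free? nothing = yes refl
  free? (just _) = no λ ()

  side-full? : ∀ (f : Labeling) s → (∀ t → Σ ℕ λ k → f (vertexAt s t) ≡ just k)
                                   ⊎ (Σ (Fin (size s)) λ t → f (vertexAt s t) ≡ nothing)
  side-full? f s with FinP.any? (λ t → free? (f (vertexAt s t)))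
  ... | yes free = inj₂ free
  ... | no ¬free = inj₁ λ t → labelled t (f (vertexAt s t)) refl
    where
    labelled : ∀ t x → f (vertexAt s t) ≡ x → Σ ℕ λ k → f (vertexAt s t) ≡ just k
    labelled t nothing e = ⊥-elim (¬free (t , e))
    labelled t (just k) e = k , e

  anyV? : {P : V → Set} → (∀ v → Dec (P v)) → Dec (Σ V P)
  anyV? P? with FinP.any? (λ i → P? (inj₁ i)) | FinP.any? (λ j → P? (inj₂ j))
  ... | yes (i , x) | _           = yes (inj₁ i , x)
  ... | no _        | yes (j , x) = yes (inj₂ j , x)
  ... | no ¬a       | no ¬b       = no λ { (inj₁ i , x) → ¬a (i , x) ; (inj₂ j , x) → ¬b (j , x) }

  private
    allV? : {P : V → Set} → (∀ v → Dec (P v)) → Dec (∀ v → P v)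
    allV? P? with FinP.all? (λ i → P? (inj₁ i)) | FinP.all? (λ j → P? (inj₂ j))
    ... | yes a | yes b = yes λ { (inj₁ i) → a i ; (inj₂ j) → b j }
    ... | no ¬a | _     = no λ h → ¬a (λ i → h (inj₁ i))
    ... | yes _ | no ¬b = no λ h → ¬b (λ j → h (inj₂ j))

    allE? : {P : Fin p × Fin q → Set} → (∀ e → Dec (P e)) → Dec (∀ e → P e)
    allE? P? with FinP.all? (λ i → FinP.all? (λ j → P? (i , j)))
    ... | yes a = yes λ { (i , j) → a i j }
    ... | no ¬a = no λ h → ¬a (λ i j → h (i , j))

    bounded? : (x : Maybe ℕ) → Dec (∀ l → x ≡ just l → l ≤ m)
    bounded? nothing = yes λ _ ()
    bounded? (just a) with a ≤? m
    ... | yes a≤m = yes λ { _ refl → a≤m }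
    ... | no a≰m = no λ h → a≰m (h a refl)

    sameLabel? : {C : Set} → (x y : Maybe ℕ) → Dec C → Dec (∀ l → x ≡ just l → y ≡ just l → C)
    sameLabel? nothing y _ = yes λ _ ()
    sameLabel? (just a) nothing _ = yes λ _ _ ()
    sameLabel? (just a) (just b) C? with a ≟ b
    ... | no a≢b = yes λ { _ refl refl → ⊥-elim (a≢b refl) }
    ... | yes refl with C?
    ...   | yes c = yes λ _ _ _ → c
    ...   | no ¬c = no λ h → ¬c (h a refl refl)

  valid? : ∀ g → Dec (Valid g)
  valid? g
    with allV? (λ v → bounded? (g v))
       | allV? (λ u → allV? (λ v → sameLabel? (g u) (g v) (u ≟V v)))
       | allE? (λ e → allE? (λ e′ → sameLabel? (edgeLabel g e) (edgeLabel g e′)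
                                     (ProdP.≡-dec FinP._≟_ FinP._≟_ e e′)))
  ... | yes a | yes b | yes c = yes (a , b , c)
  ... | no ¬a | _     | _     = no λ x → ¬a (proj₁ x)
  ... | yes _ | no ¬b | _     = no λ x → ¬b (proj₁ (proj₂ x))
  ... | yes _ | yes _ | no ¬c = no λ x → ¬c (proj₂ (proj₂ x))

  legal? : ∀ f v l → Dec (Legal f v l)
  legal? f v l with f v | valid? (update f v l)
  ... | just _  | _     = no λ ()
  ... | nothing | yes g = yes (refl , g)
  ... | nothing | no ¬g = no λ x → ¬g (proj₂ x)

  legal-bound : ∀ {f v l} → Legal f v l → l ≤ m
  legal-bound {f} {v} {l} (_ , valid) = valid-bound valid {v} (update-same f v l)

  -- Labels are bounded by m, so only finitely many moves need to be tried.
  move? : ∀ f → Dec (Σ V λ v → Σ ℕ λ l → Legal f v l)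
  move? f = anyV? λ v → labelFor v
    where
    labelFor : ∀ v → Dec (Σ ℕ λ l → Legal f v l)
    labelFor v with FinP.any? (λ (k : Fin (suc m)) → legal? f v (toℕ k))
    ... | yes (k , lg) = yes (toℕ k , lg)
    ... | no none = no λ { (l , lg) → none (fromℕ< (s≤s (legal-bound lg)) ,
                           subst (Legal f v) (sym (FinP.toℕ-fromℕ< (s≤s (legal-bound lg)))) lg) }

  complete? : ∀ f → Complete f ⊎ (Σ V λ v → f v ≡ nothing)
  complete? f with anyV? (λ v → free? (f v))
  ... | yes free = inj₂ free
  ... | no ¬free = inj₁ λ v → labelled v (f v) refl
    where
    labelled : ∀ v x → f v ≡ x → ∃ λ l → f v ≡ just l
    labelled v nothing e = ⊥-elim (¬free (v , e))
    labelled v (just l) e = l , e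

  freeVertex-incomplete : ∀ {f} v → f v ≡ nothing → ¬ Complete f
  freeVertex-incomplete v fv c = nothing≢just (trans (sym fv) (proj₂ (c v)))

  -- Every move decreases the number of free vertices: the game terminates.
  private
    countFree : Labeling → List V → ℕ
    countFree f [] = 0
    countFree f (v ∷ vs) with f v
    ... | nothing = suc (countFree f vs)
    ... | just _ = countFree f vs

    countFree-mono : ∀ f g → (∀ w → g w ≡ nothing → f w ≡ nothing) → ∀ vs → countFree g vs ≤ countFree f vs
    countFree-mono f g h [] = z≤n
    countFree-mono f g h (v ∷ vs) with g v in eg | f v in ef
    ... | nothing | nothing = s≤s (countFree-mono f g h vs)
    ... | nothing | just _ = ⊥-elim (nothing≢just (trans (sym (h v eg)) ef))
    ... | just _ | nothing = m≤n⇒m≤1+n (countFree-mono f g h vs)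
    ... | just _ | just _ = countFree-mono f g h vs

    countFree-strict : ∀ f g → (∀ w → g w ≡ nothing → f w ≡ nothing) → ∀ {v} vs → v ∈ vs →
                       f v ≡ nothing → g v ≢ nothing → countFree g vs < countFree f vs
    countFree-strict f g h (v ∷ vs) (here refl) fv gv with g v in eg | f v in ef
    ... | nothing | _ = ⊥-elim (gv refl)
    ... | just _ | nothing = s≤s (countFree-mono f g h vs)
    ... | just _ | just _ = ⊥-elim (nothing≢just (sym fv))
    countFree-strict f g h (w ∷ vs) (there v∈) fv gv with g w in eg | f w in ef
    ... | nothing | nothing = s≤s (countFree-strict f g h vs v∈ fv gv)
    ... | nothing | just _ = ⊥-elim (nothing≢just (trans (sym (h w eg)) ef))
    ... | just _ | nothing = m<n⇒m<1+n (countFree-strict f g h vs v∈ fv gv)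
    ... | just _ | just _ = countFree-strict f g h vs v∈ fv gv

    vertices : List V
    vertices = map inj₁ (allFin p) ++ map inj₂ (allFin q)

    ∈-vertices : ∀ v → v ∈ vertices
    ∈-vertices (inj₁ i) = ∈-++⁺ˡ (∈-map⁺ inj₁ (∈-allFin i))
    ∈-vertices (inj₂ j) = ∈-++⁺ʳ (map inj₁ (allFin p)) (∈-map⁺ inj₂ (∈-allFin j))

  freeCount : Labeling → ℕ
  freeCount f = countFree f vertices

  freeCount-update : ∀ f v l → f v ≡ nothing → freeCount (update f v l) < freeCount f
  freeCount-update f v l fv = countFree-strict f (update f v l) (update-free f v l) vertices (∈-vertices v) fv
                                (λ e → nothing≢just (trans (sym e) (update-same f v l)))

  Dead : Labeling → Set
  Dead f = ∀ g → f ⊑ g → Valid g → Complete g → ⊥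

  dead-update : ∀ {f v l} → Dead f → f v ≡ nothing → Dead (update f v l)
  dead-update {f} {v} {l} dead fv g ext = dead g (⊑-trans (update-extends f v l fv) ext)

  dead-incomplete : ∀ {f} → Dead f → Valid f → ¬ Complete f
  dead-incomplete {f} dead valid = dead f (λ _ _ e → e) valid

  -- From a valid dead position Bob wins, whoever is to move: he plays any legal
  -- move until the game stops, necessarily with an incomplete labelling.
  private
    mutual
      deadA : ∀ n f → freeCount f < n → Valid f → Dead f → BobWinsA f
      deadA (suc n) f c valid dead = reply (dead-incomplete dead valid) λ w l lg →
        deadB n (update f w l) (≤-trans (freeCount-update f w l (proj₁ lg)) (s≤s⁻¹ c)) (proj₂ lg)
              (dead-update dead (proj₁ lg))

      deadB : ∀ n f → freeCount f < n → Valid f → Dead f → BobWinsB f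
      deadB (suc n) f c valid dead with move? f
      ... | yes (w , l , lg) = move (dead-incomplete dead valid) w l lg
              (deadA n (update f w l) (≤-trans (freeCount-update f w l (proj₁ lg)) (s≤s⁻¹ c)) (proj₂ lg)
                     (dead-update dead (proj₁ lg)))
      ... | no none = stuck (dead-incomplete dead valid) λ w l lg → none (w , l , lg)

  dead⇒BobWinsA : ∀ {f} → Valid f → Dead f → BobWinsA f
  dead⇒BobWinsA {f} = deadA (suc (freeCount f)) f ≤-refl

  dead⇒BobWinsB : ∀ {f} → Valid f → Dead f → BobWinsB f
  dead⇒BobWinsB {f} = deadB (suc (freeCount f)) f ≤-refl

-- Complete graceful labellings of K p q (m = pq ≥ 1).  The label m must occur
-- on an edge, whose ends are then labelled 0 and m; from this we read off four
-- patterns that make a position dead.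
module Extremes (p q : ℕ) (1≤m : 1 ≤ p * q) where
  open Board p q

  ⊑-agree : ∀ {f g v l k} → f ⊑ g → f v ≡ just l → g v ≡ just k → l ≡ k
  ⊑-agree f⊑g fv gv = just-injective (trans (sym (f⊑g _ _ fv)) gv)

  -- The pq edge labels are distinct and lie in {1, …, m}, so one of them is m.
  private
    module EdgeLabels (g : Labeling) (valid : Valid g) (complete : Complete g) where
      lab : V → ℕ
      lab v = proj₁ (complete v)

      lab≡ : ∀ v → g v ≡ just (lab v)
      lab≡ v = proj₂ (complete v)

      -- edges of K p q enumerated by Fin m
      ends : Fin m → Fin p × Fin q
      ends k = remQuot q k

      a b : Fin m → V
      a k = inj₁ (proj₁ (ends k))
      b k = inj₂ (proj₂ (ends k))

      ends-distinct : ∀ {k} → a k ≢ b k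
      ends-distinct ()

      L : Fin m → ℕ
      L k = ∣ lab (a k) - lab (b k) ∣

      L-pos : ∀ k → 1 ≤ L k
      L-pos k = ∣-∣-pos {lab (a k)} {lab (b k)} λ e →
        ends-distinct (valid-injective valid (lab≡ (a k)) (trans (lab≡ (b k)) (cong just (sym e))))

      L-bound : ∀ k → L k ≤ m
      L-bound k = ≤-trans (∣m-n∣≤m⊔n (lab (a k)) (lab (b k)))
                          (⊔-lub (valid-bound valid (lab≡ (a k))) (valid-bound valid (lab≡ (b k))))

      L-injective : ∀ {k k′} → L k ≡ L k′ → k ≡ k′
      L-injective {k} {k′} e with valid-edges valid (lab≡ (a k)) (lab≡ (b k)) (lab≡ (a k′)) (lab≡ (b k′)) e
      ... | i≡ , j≡ = trans (sym (FinP.combine-remQuot {p} q k))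
                            (trans (cong₂ combine i≡ j≡) (FinP.combine-remQuot {p} q k′))

      topLabel : Σ (Fin p) λ i → Σ (Fin q) λ j → ∣ lab (inj₁ i) - lab (inj₂ j) ∣ ≡ m
      topLabel with distinct-hitsTop m L L-injective L-pos L-bound 1≤m
      ... | k , Lk≡m = proj₁ (ends k) , proj₂ (ends k) , Lk≡m

    topEdge : ∀ g → Valid g → Complete g → Σ (Fin p) λ i → Σ (Fin q) λ j →
              (g (inj₁ i) ≡ just 0 × g (inj₂ j) ≡ just m) ⊎ (g (inj₁ i) ≡ just m × g (inj₂ j) ≡ just 0)
    topEdge g valid complete =
      let (i , j , eq) = topLabel in
      i , j , Sum.map (λ (a , b) → at (inj₁ i) a , at (inj₂ j) b) (λ (a , b) → at (inj₁ i) a , at (inj₂ j) b)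
                (∣-∣-extremes eq (valid-bound valid (lab≡ (inj₁ i))) (valid-bound valid (lab≡ (inj₂ j))))
      where
      open EdgeLabels g valid complete
      at : ∀ v {l} → lab v ≡ l → g v ≡ just l
      at v e = trans (lab≡ v) (cong just e)

  extremeEdge : ∀ g → Valid g → Complete g → ∀ s →
                Σ (Fin (size s)) λ i → Σ (Fin (size (not s))) λ j →
                  (g (vertexAt s i) ≡ just 0 × g (vertexAt (not s) j) ≡ just m)
                ⊎ (g (vertexAt s i) ≡ just m × g (vertexAt (not s) j) ≡ just 0)
  extremeEdge g valid complete true = topEdge g valid complete
  extremeEdge g valid complete false with topEdge g valid complete
  ... | i , j , inj₁ (a , b) = j , i , inj₂ (b , a)
  ... | i , j , inj₂ (a , b) = j , i , inj₁ (b , a)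

  dead-sameSide : ∀ f s {i i′} → f (vertexAt s i) ≡ just 0 → f (vertexAt s i′) ≡ just m → Dead f
  dead-sameSide f s f0 fm g ext valid complete with extremeEdge g valid complete s
  ... | _ , _ , inj₁ (_ , gm) = vertexAt-opposite s (valid-injective valid (ext _ _ fm) gm)
  ... | _ , _ , inj₂ (_ , g0) = vertexAt-opposite s (valid-injective valid (ext _ _ f0) g0)

  -- Nonzero α and β with α + β = m on opposite sides: the edges 0–β and α–m
  -- (or m–β and α–0) would carry the same label.
  dead-complementary : ∀ f s {i j α β} → f (vertexAt s i) ≡ just α → f (vertexAt (not s) j) ≡ just β →
                       α + β ≡ m → α ≢ 0 → β ≢ 0 → Dead f
  dead-complementary f s {i} {j} {α} {β} fα fβ sum α≢0 β≢0 g ext valid complete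
    with extremeEdge g valid complete s
  ... | i₀ , j₀ , inj₁ (g0 , gm) =
        α≢0 (⊑-agree ext fα (subst (λ t → g (vertexAt s t) ≡ just 0) (proj₁ same) g0))
    where
    same : i₀ ≡ i × j ≡ j₀
    same = valid-edgesAt valid s g0 (ext _ _ fβ) (ext _ _ fα) gm (sym (∣-∣-join α m β (inj₂ (sym sum))))
  ... | i₀ , j₀ , inj₂ (gm , g0) =
        β≢0 (⊑-agree ext fβ (subst (λ t → g (vertexAt (not s) t) ≡ just 0) (sym (proj₂ same)) g0))
    where
    same : i₀ ≡ i × j ≡ j₀
    same = valid-edgesAt valid s gm (ext _ _ fβ) (ext _ _ fα) g0
                   (trans (∣-∣-join m β α (inj₁ (trans (sym sum) (+-comm α β)))) (sym (∣-∣-identityʳ α)))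

  dead-fullSide : ∀ f s → (∀ i → Σ ℕ λ l → f (vertexAt s i) ≡ just l × l ≢ 0 × l ≢ m) → Dead f
  dead-fullSide f s full g ext valid complete with extremeEdge g valid complete s
  ... | i₀ , _ , inj₁ (g0 , _) = let (l , fl , l≢0 , _) = full i₀ in l≢0 (⊑-agree ext fl g0)
  ... | i₀ , _ , inj₂ (gm , _) = let (l , fl , _ , l≢m) = full i₀ in l≢m (⊑-agree ext fl gm)

  -- 1 and n = m − 1 on one side, 2 on the other: the edge of label ∣1 − 2∣ = 1
  -- collides with the edge n–m or with the edge 1–0.
  dead-oneTwo : ∀ f s {n i i′ j} → suc n ≡ m → f (vertexAt s i) ≡ just 1 → f (vertexAt s i′) ≡ just n →
                f (vertexAt (not s) j) ≡ just 2 → n ≢ 1 → Dead f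
  dead-oneTwo f s {n} {i} {i′} {j} 1+n≡m f1 fn f2 n≢1 g ext valid complete
    with extremeEdge g valid complete s
  ... | i₀ , j₀ , inj₁ (g0 , gm) =
        n≢1 (⊑-agree ext fn (subst (λ t → g (vertexAt s t) ≡ just 1) (sym (proj₁ same)) (ext _ _ f1)))
    where
    same : i′ ≡ i × j₀ ≡ j
    same = valid-edgesAt valid s (ext _ _ fn) gm (ext _ _ f1) (ext _ _ f2)
                   (∣-∣-join n m 1 (inj₂ (sym (trans (+-comm n 1) 1+n≡m))))
  ... | i₀ , j₀ , inj₂ (gm , g0) =
        0≢1+n (sym (⊑-agree ext f2 (subst (λ t → g (vertexAt (not s) t) ≡ just 0) (proj₂ same) g0)))
    where
    same : i ≡ i × j₀ ≡ j
    same = valid-edgesAt valid s (ext _ _ f1) g0 (ext _ _ f1) (ext _ _ f2) refl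

-- Alice wins on the star K 1 q by labelling the centre 0.  From then on every
-- edge label equals the label of its leaf, so a move is legal as soon as its
-- label is unused; and while a leaf is free one of the q labels 1, …, q is
-- unused.  Hence the player to move is never stuck, and the game ends with a
-- complete graceful labelling.
module Star (q : ℕ) where
  open Board 1 q

  centre : V
  centre = inj₁ zero

  m≡q : m ≡ q
  m≡q = *-identityˡ q

  centred-valid : ∀ h → h centre ≡ just 0 → (∀ v l → h v ≡ just l → l ≤ m) →
                  (∀ u v l → h u ≡ just l → h v ≡ just l → u ≡ v) → Valid h
  centred-valid h h0 bound inj = bound , inj , edges
    where
    leafLabel : ∀ j d → edgeLabel h (zero , j) ≡ just d → h (inj₂ j) ≡ just d
    leafLabel j d e with edgeLabel-elim h zero j d e
    ... | a , b , ha , hb , eq with just-injective (trans (sym h0) ha)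
    ... | refl = trans hb (cong just eq)
    edges : ∀ e e′ d → edgeLabel h e ≡ just d → edgeLabel h e′ ≡ just d → e ≡ e′
    edges (zero , j) (zero , j′) d e e′ with inj (inj₂ j) (inj₂ j′) d (leafLabel j d e) (leafLabel j′ d e′)
    ... | refl = refl

  centred-legal : ∀ f v l → Valid f → f centre ≡ just 0 → f v ≡ nothing → l ≤ m →
                  (∀ u → f u ≢ just l) → Legal f v l
  centred-legal f v l valid f0 fv l≤m unused =
    fv , centred-valid (update f v l) (update-extends f v l fv centre 0 f0) bound inj
    where
    bound : ∀ w k → update f v l w ≡ just k → k ≤ m
    bound w k e with update-cases f v l w k e
    ... | inj₁ (_ , refl) = l≤m
    ... | inj₂ (_ , fw) = valid-bound valid fw
    inj : ∀ u w k → update f v l u ≡ just k → update f v l w ≡ just k → u ≡ w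
    inj u w k eu ew with update-cases f v l u k eu | update-cases f v l w k ew
    ... | inj₁ (refl , _) | inj₁ (refl , _) = refl
    ... | inj₁ (_ , refl) | inj₂ (_ , fw) = ⊥-elim (unused w fw)
    ... | inj₂ (_ , fu) | inj₁ (_ , refl) = ⊥-elim (unused u fu)
    ... | inj₂ (_ , fu) | inj₂ (_ , fw) = valid-injective valid fu fw

  Centred : Labeling → Set
  Centred f = f centre ≡ just 0 × Valid f

  centred-update : ∀ {f w l} → Centred f → Legal f w l → Centred (update f w l)
  centred-update {f} {w} {l} (f0 , _) (fw , valid) = update-extends f w l fw centre 0 f0 , valid

  used? : ∀ (f : Labeling) l → Dec (Σ V λ u → f u ≡ just l)
  used? f l = anyV? λ u → MaybeP.≡-dec _≟_ (f u) (just l)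

  -- While the leaf j is free, some label in {1, …, q} is unused: otherwise the q
  -- labels would sit on q distinct leaves other than j.
  unusedLabel : ∀ f → Centred f → ∀ j → f (inj₂ j) ≡ nothing → Σ ℕ λ l → l ≤ q × (∀ u → f u ≢ just l)
  unusedLabel f (f0 , valid) j fj with FinP.any? (λ k → ¬? (used? f (suc (toℕ k))))
  ... | yes (k , unused) = suc (toℕ k) , FinP.toℕ<n k , λ u e → unused (u , e)
  ... | no allUsed = ⊥-elim (1+n≰n (FinP.injective⇒≤ {f = index} index-injective))
    where
    owner : ∀ k → Σ V λ u → f u ≡ just (suc (toℕ k))
    owner k with used? f (suc (toℕ k))
    ... | yes o = o
    ... | no ¬o = ⊥-elim (allUsed (k , ¬o))
    leaf : ∀ {u l} → f u ≡ just (suc l) → Σ (Fin q) λ j′ → u ≡ inj₂ j′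
    leaf {inj₁ zero} e with trans (sym f0) e
    ... | ()
    leaf {inj₂ j′} _ = j′ , refl
    index : Fin (suc q) → Fin q
    index zero = j
    index (suc k) = proj₁ (leaf (proj₂ (owner k)))
    index-label : ∀ k → f (inj₂ (index (suc k))) ≡ just (suc (toℕ k))
    index-label k = subst (λ u → f u ≡ _) (proj₂ (leaf (proj₂ (owner k)))) (proj₂ (owner k))
    index-injective : ∀ {k k′} → index k ≡ index k′ → k ≡ k′
    index-injective {zero} {zero} _ = refl
    index-injective {zero} {suc k} e = ⊥-elim (free≢labelled {f} fj (index-label k) (cong inj₂ e))
    index-injective {suc k} {zero} e = ⊥-elim (free≢labelled {f} fj (index-label k) (cong inj₂ (sym e)))
    index-injective {suc k} {suc k′} e = cong suc (FinP.toℕ-injective (suc-injective (just-injective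
      (trans (sym (index-label k)) (trans (cong (f ∘ inj₂) e) (index-label k′))))))

  someMove : ∀ f → Centred f → ∀ v → f v ≡ nothing → Σ V λ w → Σ ℕ λ l → Legal f w l
  someMove f (f0 , _) (inj₁ zero) fv = ⊥-elim (nothing≢just (trans (sym fv) f0))
  someMove f c@(f0 , valid) (inj₂ j) fv with unusedLabel f c j fv
  ... | l , l≤q , unused = inj₂ j , l , centred-legal f (inj₂ j) l valid f0 fv (subst (l ≤_) (sym m≡q) l≤q) unused

  private
    mutual
      aliceA : ∀ n f → freeCount f < n → Centred f → AliceWinsA f
      aliceA (suc n) f c centred with complete? f
      ... | inj₁ complete = done complete
      ... | inj₂ (v , fv) with someMove f centred v fv
      ...   | w , l , lg = move w l lg (aliceB n (update f w l) (≤-trans (freeCount-update f w l (proj₁ lg)) (s≤s⁻¹ c))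
                                              (centred-update centred lg))

      aliceB : ∀ n f → freeCount f < n → Centred f → AliceWinsB f
      aliceB (suc n) f c centred with complete? f
      ... | inj₁ complete = done complete
      ... | inj₂ (v , fv) = reply (someMove f centred v fv) λ w l lg →
              aliceA n (update f w l) (≤-trans (freeCount-update f w l (proj₁ lg)) (s≤s⁻¹ c)) (centred-update centred lg)

  aliceWins : AliceWinsFirst (K 1 q)
  aliceWins = move centre 0 opening (aliceB _ _ ≤-refl (update-same empty centre 0 , proj₂ opening))
    where
    opening : Legal empty centre 0
    opening = legal-place [] centre 0 valid-empty refl z≤n [] (λ { (_ , _) _ () }) []

-- Sizes in Alice's "half" opening x = m/2.
half-≥3 : ∀ x → 6 ≤ x + x → 3 ≤ x
half-≥3 (suc (suc (suc _))) _ = s≤s (s≤s (s≤s z≤n))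
half-≥3 0 ()
half-≥3 1 (s≤s (s≤s ()))
half-≥3 2 (s≤s (s≤s (s≤s (s≤s ()))))

half-large : ∀ Y → 8 ≤ (3 + Y) + (3 + Y) → 1 ≤ Y
half-large zero (s≤s (s≤s (s≤s (s≤s (s≤s (s≤s ()))))))
half-large (suc _) _ = s≤s z≤n

-- Facts about n = m - 1 used in every branch of Bob's threat strategy (n ≥ 3).

∣n-z∣≢∣n-1∣ : ∀ {n z} → 3 ≤ n → z ≢ 1 → z ≤ suc n → ∣ n - z ∣ ≢ ∣ n - 1 ∣
∣n-z∣≢∣n-1∣ {n@(suc (suc (suc k)))} {z} (s≤s (s≤s (s≤s z≤n))) z≢1 z≤ = ∣-∣-≢ n z n 1
  (λ e → z≢1 (+-cancelʳ-≡ n z 1 (trans (sym e) (+-comm n 1))))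
  (λ e → beyond≰ k (l k) (subst (_≤ suc n + 1) (sym e) (+-monoˡ-≤ 1 z≤)))
  where l : ∀ k → (3 + k) + (3 + k) ≡ (suc (3 + k) + 1) + suc k
        l = solve-∀

∣n-1∣≢∣1-z∣ : ∀ {n z} → 3 ≤ n → z ≢ n → ∣ n - 1 ∣ ≢ ∣ 1 - z ∣
∣n-1∣≢∣1-z∣ {n} {z} 3≤n z≢n = ∣-∣-≢ n 1 1 z
  (λ e → <⇒≱ 3≤n (subst (n ≤_) e (m≤m+n n z)))
  (λ e → z≢n (sym (suc-injective (trans (+-comm 1 n) e))))

∣2-n∣≢∣2-1∣ : ∀ {n} → 4 ≤ n → ∣ 2 - n ∣ ≢ ∣ 2 - 1 ∣
∣2-n∣≢∣2-1∣ (s≤s (s≤s (s≤s (s≤s _)))) ()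

-- Facts for the case where Alice's first label is x = m/2, written with
-- x = 3 + Y and n = m - 1 = 5 + 2Y.
module HalfArithmetic (Y : ℕ) where
  x n : ℕ
  x = 3 + Y
  n = 5 + (Y + Y)

  x+x≡n+1 : x + x ≡ n + 1
  x+x≡n+1 = l Y
    where l : ∀ Y → (3 + Y) + (3 + Y) ≡ (5 + (Y + Y)) + 1
          l = solve-∀

  n≢x : n ≢ x
  n≢x = beyond≢ (1 + Y) (l Y)
    where l : ∀ Y → 5 + (Y + Y) ≡ (3 + Y) + suc (1 + Y)
          l = solve-∀

  ∣n-1∣≢∣n-x∣ : ∣ n - 1 ∣ ≢ ∣ n - x ∣
  ∣n-1∣≢∣n-x∣ = ∣-∣-≢ n 1 n x
    (λ e → x≢1 (+-cancelʳ-≡ n x 1 (trans (+-comm x n) e)))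
    (beyond≢ (5 + Y * 3) (l Y))
    where x≢1 : x ≢ 1
          x≢1 ()
          l : ∀ Y → (5 + (Y + Y)) + (5 + (Y + Y)) ≡ (1 + (3 + Y)) + suc (5 + Y * 3)
          l = solve-∀

  ∣n-z∣≢∣n-x∣ : ∀ {z} → z ≢ x → z ≤ suc n → ∣ n - z ∣ ≢ ∣ n - x ∣
  ∣n-z∣≢∣n-x∣ {z} z≢x z≤ = ∣-∣-≢ n z n x
    (λ e → z≢x (+-cancelʳ-≡ n z x (trans (sym e) (+-comm n x))))
    (λ e → beyond≰ Y (l Y) (subst (_≤ suc n + x) (sym e) (+-monoˡ-≤ x z≤)))
    where l : ∀ Y → (5 + (Y + Y)) + (5 + (Y + Y)) ≡ (suc (5 + (Y + Y)) + (3 + Y)) + suc Y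
          l = solve-∀

  private
    n≡x+1+1+Y : n ≡ (x + 1) + suc Y
    n≡x+1+1+Y = l Y
      where l : ∀ Y → 5 + (Y + Y) ≡ ((3 + Y) + 1) + suc Y
            l = solve-∀

  ∣n-1∣≢∣x-z∣ : ∀ {z} → z ≤ suc n → ∣ n - 1 ∣ ≢ ∣ x - z ∣
  ∣n-1∣≢∣x-z∣ {z} z≤ = ∣-∣-≢ n 1 x z
    (λ e → beyond≰ Y (trans n≡x+1+1+Y (cong (_+ suc Y) (+-comm x 1)))
                       (subst (n ≤_) e (m≤m+n n z)))
    (λ e → beyond≰ Y (l Y) (subst (_≤ 1 + suc n) (sym e) (s≤s z≤)))
    where l : ∀ Y → (5 + (Y + Y)) + (3 + Y) ≡ (1 + suc (5 + (Y + Y))) + suc Y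
          l = solve-∀

  ∣n-x∣≢∣1-z∣ : ∀ {z} → z ≢ x → ∣ n - x ∣ ≢ ∣ 1 - z ∣
  ∣n-x∣≢∣1-z∣ {z} z≢x = ∣-∣-≢ n x 1 z
    (λ e → beyond≰ Y n≡x+1+1+Y (subst (n ≤_) e (m≤m+n n z)))
    (λ e → z≢x (sym (+-cancelˡ-≡ x x z (trans x+x≡n+1 e))))

  ∣n-x∣≢∣x-z∣ : ∀ {z} → z ≢ 1 → z ≢ n → ∣ n - x ∣ ≢ ∣ x - z ∣
  ∣n-x∣≢∣x-z∣ {z} z≢1 z≢n = ∣-∣-≢ n x x z
    (λ e → z≢1 (+-cancelˡ-≡ n z 1 (trans e x+x≡n+1)))
    (λ e → z≢n (sym (+-cancelˡ-≡ x n z (trans (+-comm x n) e))))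

  ∣2-n∣≢∣2-x∣ : ∣ 2 - n ∣ ≢ ∣ 2 - x ∣
  ∣2-n∣≢∣2-x∣ = beyond≢ (1 + Y) (l Y)
    where l : ∀ Y → 3 + (Y + Y) ≡ (1 + Y) + suc (1 + Y)
          l = solve-∀

  ∣2-1∣≢∣2-x∣ : 1 ≤ Y → ∣ 2 - 1 ∣ ≢ ∣ 2 - x ∣
  ∣2-1∣≢∣2-x∣ (s≤s _) ()

module BobWins (p q : ℕ) (2≤p : 2 ≤ p) (2≤q : 2 ≤ q) where
  open Board p q

  4≤m : 4 ≤ m
  4≤m = *-mono-≤ 2≤p 2≤q

  1≤m : 1 ≤ m
  1≤m = ≤-trans (s≤s z≤n) 4≤m

  open Extremes p q 1≤m

  size≥2 : ∀ s → 2 ≤ size s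
  size≥2 true = 2≤p
  size≥2 false = 2≤q

  first : ∀ s → Fin (size s)
  first s = fin-first (size≥2 s)

  other : ∀ s → Fin (size s) → Fin (size s)
  other s = fin-other (size≥2 s)

  -- r distinct vertices on one side force m ≥ 2r, since the other side has at least two.
  sideBound : ∀ s (ts : List (Fin (size s))) → AllPairs _≢_ ts → length ts * 2 ≤ m
  sideBound s ts distinct =
    ≤-trans (*-mono-≤ (distinct-length≤ ts distinct) (size≥2 (not s))) (≤-reflexive (sizes s))
    where
    sizes : ∀ s → size s * size (not s) ≡ m
    sizes true = refl
    sizes false = *-comm q p

  free≢labelledAt : ∀ {f : Labeling} {s t u k} → f (vertexAt s t) ≡ nothing → f (vertexAt s u) ≡ just k → t ≢ u
  free≢labelledAt {f} {s} {t} {u} ft fu e =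
    free≢labelled {f} {vertexAt s t} {vertexAt s u} ft fu (cong (vertexAt s) e)

  dead-fullPlacement : ∀ ps s → All (λ (_ , k) → k ≢ 0 × k ≢ m) ps →
                       (∀ t → Σ ℕ λ k → place ps (vertexAt s t) ≡ just k) → Dead (place ps)
  dead-fullPlacement ps s inner full = dead-fullSide (place ps) s λ t →
    let (k , e) = full t in k , e , All.lookup inner (place-support ps e)

  bobMoves : ∀ {f v l} → (lg : Legal f v l) → BobWinsA (update f v l) → BobWinsB f
  bobMoves {v = v} lg = move (freeVertex-incomplete v (proj₁ lg)) v _ lg

  bobKills : ∀ {f v l} → (lg : Legal f v l) → Dead (update f v l) → BobWinsB f
  bobKills lg dead = bobMoves lg (dead⇒BobWinsA (proj₂ lg) dead)

  secondMove-legal : ∀ {s i x v l} → Legal empty (vertexAt s i) x → v ≢ vertexAt s i → l ≤ m → x ≢ l →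
                     Legal (place ((vertexAt s i , x) ∷ [])) v l
  secondMove-legal {s} {i} lg v≢ l≤m x≢l =
    legal-place _ _ _ (proj₂ lg) (place-free _ ((λ e → v≢ (sym e)) ∷ [])) l≤m (x≢l ∷ [])
      (λ e d ed → ⊥-elim (oneSided-noEdge _ s (side-vertexAt s i ∷ []) e d ed)) ([] ∷ [])

  -- Conditions making Bob's answer 2 on side ¬s legal, when labels ps and n lie on side s.
  TwoAnswerable : ℕ → List (V × ℕ) → Set
  TwoAnswerable n ps = All (λ (_ , k) → k ≢ 2 × ∣ 2 - n ∣ ≢ ∣ 2 - k ∣) ps
                     × AllPairs (λ (_ , k) (_ , k′) → ∣ 2 - k ∣ ≢ ∣ 2 - k′ ∣) ps

  -- All labels lie on side s, one of them is 1, Alice is to move,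
  -- and n = m − 1.  Bob answers:
  --  * n on side ¬s by Alice: the position is dead (1 + n = m, dead-complementary);
  --  * z ≠ n anywhere: n on a free vertex of side ¬s, again dead-complementary;
  --  * n on side s: the side is full (dead-fullSide) or Bob puts 2 on side ¬s
  --    (dead-oneTwo).
  -- The parameters say that the labels present make these answers legal.
  module Threat
    (s : Bool) (n : ℕ) (1+n≡m : suc n ≡ m) (3≤n : 3 ≤ n)
    (ps : List (V × ℕ)) (valid : Valid (place ps))
    (onSide : All (λ (u , _) → side u ≡ s) ps)
    (labelled : All (λ (u , k) → place ps u ≡ just k) ps)
    (a : Fin (size s)) (hasOne : place ps (vertexAt s a) ≡ just 1)
    (inner : All (λ (_ , k) → k ≢ 0 × k ≢ m) ps)
    (n-fresh : All (λ (_ , k) → k ≢ n) ps)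
    (n-distinct : AllPairs (λ (_ , k) (_ , k′) → ∣ n - k ∣ ≢ ∣ n - k′ ∣) ps)
    (n-sameSide : ∀ {z} → z ≤ suc n → All (λ (_ , k) → z ≢ k) ps →
                  All (λ (_ , k) → ∣ n - z ∣ ≢ ∣ n - k ∣) ps)
    (n-otherSide : ∀ {z} → z ≤ suc n → z ≢ n → All (λ (_ , k) → z ≢ k) ps →
                   All (λ (_ , k) → All (λ (_ , k′) → ∣ n - k ∣ ≢ ∣ k′ - z ∣) ps) ps)
    (two : ∀ {i t} → i ≢ t → place ps (vertexAt s i) ≡ nothing → place ps (vertexAt s t) ≡ nothing →
           TwoAnswerable n ps)
    where

    n≤m : n ≤ m
    n≤m = subst (n ≤_) 1+n≡m (n≤1+n n)

    2≤m : 2 ≤ m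
    2≤m = ≤-trans (≤-trans (n≤1+n 2) 3≤n) n≤m

    n≢0 : n ≢ 0
    n≢0 = >⇒≢ (≤-trans (s≤s z≤n) 3≤n)

    n≢1 : n ≢ 1
    n≢1 = >⇒≢ (≤-trans (s≤s (s≤s z≤n)) 3≤n)

    n≢2 : n ≢ 2
    n≢2 = >⇒≢ 3≤n

    n≢m : n ≢ m
    n≢m e = 1+n≢n (trans 1+n≡m (sym e))

    bound : ∀ {w z} → Legal (place ps) w z → z ≤ suc n
    bound {w} {z} lg = subst (z ≤_) (sym 1+n≡m) (legal-bound {place ps} {w} {z} lg)

    fresh : ∀ {w z} → Legal (place ps) w z → All (λ (_ , k) → z ≢ k) ps
    fresh lg = All.map (legal-newLabel lg) labelled

    hasOne′ : ∀ {w z} → Legal (place ps) w z → place ((w , z) ∷ ps) (vertexAt s a) ≡ just 1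
    hasOne′ {w} {z} lg = update-extends (place ps) w z (proj₁ lg) (vertexAt s a) 1 hasOne

    noEdges : ∀ i z e d → edgeLabel (place ((vertexAt s i , z) ∷ ps)) e ≡ just d → ⊥
    noEdges i z = oneSided-noEdge ((vertexAt s i , z) ∷ ps) s (side-vertexAt s i ∷ onSide)

    target : V
    target = vertexAt (not s) (first (not s))

    target-free : ∀ i z → place ((vertexAt s i , z) ∷ ps) target ≡ nothing
    target-free i z = oneSided-free ((vertexAt s i , z) ∷ ps) s (side-vertexAt s i ∷ onSide) (opposite-side s _)

    -- Alice puts n opposite the 1: dead already.
    takenOpposite : ∀ j → (lg : Legal (place ps) (vertexAt (not s) j) n) →
                    BobWinsB (place ((vertexAt (not s) j , n) ∷ ps))
    takenOpposite j lg =
      dead⇒BobWinsB (proj₂ lg) (dead-complementary _ s {a} {j} (hasOne′ lg)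
                                   (update-same (place ps) (vertexAt (not s) j) n) 1+n≡m (λ ()) n≢0)

    -- Alice puts z ≠ n on side s: Bob puts n on side ¬s.
    sameSide : ∀ i z → z ≢ n → (lg : Legal (place ps) (vertexAt s i) z) →
               BobWinsB (place ((vertexAt s i , z) ∷ ps))
    sameSide i z z≢n lg = bobKills answer
      (dead-complementary _ s {a} {first (not s)}
         (update-extends (place ((vertexAt s i , z) ∷ ps)) target n (target-free i z) (vertexAt s a) 1 (hasOne′ lg))
         (update-same (place ((vertexAt s i , z) ∷ ps)) target n) 1+n≡m (λ ()) n≢0)
      where
      answer : Legal (place ((vertexAt s i , z) ∷ ps)) target n
      answer = legal-place _ target n (proj₂ lg) (target-free i z) n≤m (z≢n ∷ n-fresh)
                 (λ e d ed → ⊥-elim (noEdges i z e d ed))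
                 (All.map (λ ne _ _ → ne) (n-sameSide (bound lg) (fresh lg))
                  ∷ AllPairs.map (λ ne _ _ → ne) n-distinct)

    -- Alice puts z ≠ n on side ¬s: Bob puts n on another vertex of side ¬s; its
    -- new edges must avoid the old ones, which all start at Alice's vertex.
    oppositeSide : ∀ j z → z ≢ n → (lg : Legal (place ps) (vertexAt (not s) j) z) →
                   BobWinsB (place ((vertexAt (not s) j , z) ∷ ps))
    oppositeSide j z z≢n lg = bobKills answer
      (dead-complementary _ s {a} {j′}
         (update-extends (place ((vertexAt (not s) j , z) ∷ ps)) v n free (vertexAt s a) 1 (hasOne′ lg))
         (update-same (place ((vertexAt (not s) j , z) ∷ ps)) v n) 1+n≡m (λ ()) n≢0)
      where
      j′ : Fin (size (not s))
      j′ = other (not s) j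
      v : V
      v = vertexAt (not s) j′
      sameSides : side (vertexAt (not s) j) ≡ side v
      sameSides = trans (side-vertexAt (not s) j) (sym (side-vertexAt (not s) j′))
      free : place ((vertexAt (not s) j , z) ∷ ps) v ≡ nothing
      free = place-free _ ((λ e → fin-other≢ (size≥2 (not s)) j (sym (vertexAt-injective (not s) e)))
                           ∷ All.map (λ su e → opposite-side s j′ (trans (cong side (sym e)) su)) onSide)
      avoid : ∀ {k d} → All (λ (_ , k′) → ∣ n - k ∣ ≢ ∣ k′ - z ∣) ps → Any (λ (_ , k′) → ∣ k′ - z ∣ ≡ d) ps →
              ∣ n - k ∣ ≢ d
      avoid all old eq = let (ne , e) = All.lookupAny all old in ne (trans eq (sym e))
      answer : Legal (place ((vertexAt (not s) j , z) ∷ ps)) v n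
      answer = legal-place _ v n (proj₂ lg) free n≤m (z≢n ∷ n-fresh)
                 (λ e d ed → (λ adj → ⊥-elim (adj sameSides))
                   ∷ All.map (λ cond _ → avoid cond (starEdge ps s (vertexAt (not s) j) z onSide e d ed))
                             (n-otherSide (bound lg) z≢n (fresh lg)))
                 (All.tabulate (λ _ adj → ⊥-elim (adj sameSides))
                  ∷ AllPairs.map (λ ne _ _ → ne) n-distinct)

    -- Alice puts n on side s: the side is full, or Bob puts 2 on side ¬s.
    takenSameSide : ∀ i → (lg : Legal (place ps) (vertexAt s i) n) → BobWinsB (place ((vertexAt s i , n) ∷ ps))
    takenSameSide i lg with side-full? (place ((vertexAt s i , n) ∷ ps)) s
    ... | inj₁ full = dead⇒BobWinsB (proj₂ lg) (dead-fullPlacement _ s ((n≢0 , n≢m) ∷ inner) full)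
    ... | inj₂ (t , ft) = bobKills answer
          (dead-oneTwo _ s {n} {a} {i} {first (not s)} 1+n≡m
             (update-extends f′ target 2 (target-free i n) (vertexAt s a) 1 (hasOne′ lg))
             (update-extends f′ target 2 (target-free i n) (vertexAt s i) n (update-same (place ps) (vertexAt s i) n))
             (update-same f′ target 2) n≢1)
      where
      f′ : Labeling
      f′ = place ((vertexAt s i , n) ∷ ps)
      conditions : TwoAnswerable n ps
      conditions = two {i} {t}
        (λ e → free≢labelledAt {f′} {s} {t} {i} ft (update-same (place ps) (vertexAt s i) n) (sym e))
        (proj₁ lg) (update-free (place ps) (vertexAt s i) n (vertexAt s t) ft)
      answer : Legal (place ((vertexAt s i , n) ∷ ps)) target 2
      answer = legal-place _ target 2 (proj₂ lg) (target-free i n) 2≤m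
                 (n≢2 ∷ All.map proj₁ (proj₁ conditions))
                 (λ e d ed → ⊥-elim (noEdges i n e d ed))
                 (All.map (λ c _ _ → proj₂ c) (proj₁ conditions)
                  ∷ AllPairs.map (λ ne _ _ → ne) (proj₂ conditions))

    bobWins : BobWinsA (place ps)
    bobWins = reply (freeVertex-incomplete target (oneSided-free ps s onSide (opposite-side s _))) respond
      where
      respond : ∀ w z → Legal (place ps) w z → BobWinsB (place ((w , z) ∷ ps))
      respond w z lg with vertexAt-cases s w | z ≟ n
      ... | inj₁ (i , refl) | yes refl = takenSameSide i lg
      ... | inj₁ (i , refl) | no z≢n   = sameSide i z z≢n lg
      ... | inj₂ (j , refl) | yes refl = takenOpposite j lg
      ... | inj₂ (j , refl) | no z≢n   = oppositeSide j z z≢n lg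

  other≢ : ∀ s i → vertexAt s (other s i) ≢ vertexAt s i
  other≢ s i e = fin-other≢ (size≥2 s) i (vertexAt-injective s e)

  1≢m : 1 ≢ m
  1≢m = <⇒≢ (≤-trans (s≤s (s≤s z≤n)) 4≤m)

  keepOpening : ∀ {w x v l} → Legal (place ((w , x) ∷ [])) v l → place ((v , l) ∷ (w , x) ∷ []) w ≡ just x
  keepOpening {w} {x} {v} {l} lg = update-extends (place ((w , x) ∷ [])) v l (proj₁ lg) w x (update-same empty w x)

  -- After Alice's x = m/2 and Bob's 1 on the same side, with a vertex of that
  -- side still free: the threat position, with n = m − 1 = 2x − 1.
  halfThreat : ∀ s i x → 3 ≤ x → x + x ≡ m → (one : Legal (place ((vertexAt s i , x) ∷ [])) (vertexAt s (other s i)) 1) →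
               BobWinsA (place ((vertexAt s (other s i) , 1) ∷ (vertexAt s i , x) ∷ []))
  halfThreat s i _ (s≤s (s≤s (s≤s {n = Y} z≤n))) x+x≡m one =
    Threat.bobWins s n 1+n≡m (s≤s (s≤s (s≤s z≤n))) ps (proj₂ one)
      (side-vertexAt s a ∷ side-vertexAt s i ∷ []) (fa ∷ fi ∷ []) a fa
      (((λ ()) , 1≢m) ∷ ((λ ()) , x≢m) ∷ [])
      ((λ ()) ∷ (λ e → n≢x (sym e)) ∷ [])
      ((∣n-1∣≢∣n-x∣ ∷ []) ∷ [] ∷ [])
      (λ { z≤ (z≢1 ∷ z≢x ∷ []) → ∣n-z∣≢∣n-1∣ 3≤n z≢1 z≤ ∷ ∣n-z∣≢∣n-x∣ z≢x z≤ ∷ [] })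
      (λ { z≤ z≢n (z≢1 ∷ z≢x ∷ []) → (∣n-1∣≢∣1-z∣ 3≤n z≢n ∷ ∣n-1∣≢∣x-z∣ z≤ ∷ [])
                                     ∷ (∣n-x∣≢∣1-z∣ z≢x ∷ ∣n-x∣≢∣x-z∣ z≢1 z≢n ∷ []) ∷ [] })
      two
    where
    open HalfArithmetic Y
    a : Fin (size s)
    a = other s i
    ps : List (V × ℕ)
    ps = (vertexAt s a , 1) ∷ (vertexAt s i , x) ∷ []
    3≤n : 3 ≤ n
    3≤n = s≤s (s≤s (s≤s z≤n))
    1+n≡m : suc n ≡ m
    1+n≡m = trans (+-comm 1 n) (trans (sym x+x≡n+1) x+x≡m)
    x≢m : x ≢ m
    x≢m e = m+1+n≢m x (trans x+x≡m (sym e))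
    fa : place ps (vertexAt s a) ≡ just 1
    fa = update-same (place ((vertexAt s i , x) ∷ [])) (vertexAt s a) 1
    fi : place ps (vertexAt s i) ≡ just x
    fi = keepOpening one
    -- a fourth vertex on side s forces m ≥ 8, i.e. x ≥ 4
    two : ∀ {i₃ t} → i₃ ≢ t → place ps (vertexAt s i₃) ≡ nothing → place ps (vertexAt s t) ≡ nothing →
          TwoAnswerable n ps
    two {i₃} {t} i₃≢t fi₃ ft =
      ((λ ()) , ∣2-n∣≢∣2-1∣ (s≤s (s≤s (s≤s (s≤s z≤n))))) ∷ ((λ ()) , ∣2-n∣≢∣2-x∣) ∷ [] ,
      (∣2-1∣≢∣2-x∣ 1≤Y ∷ []) ∷ [] ∷ []
      where
      distinct : AllPairs _≢_ (t ∷ i₃ ∷ a ∷ i ∷ [])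
      distinct = ((λ e → i₃≢t (sym e)) ∷ free≢labelledAt {place ps} {s} {t} {a} ft fa
                                         ∷ free≢labelledAt {place ps} {s} {t} {i} ft fi ∷ [])
               ∷ (free≢labelledAt {place ps} {s} {i₃} {a} fi₃ fa
                  ∷ free≢labelledAt {place ps} {s} {i₃} {i} fi₃ fi ∷ [])
               ∷ ((λ e → other≢ s i (cong (vertexAt s) e)) ∷ []) ∷ [] ∷ []
      1≤Y : 1 ≤ Y
      1≤Y = half-large Y (subst (8 ≤_) (sym x+x≡m) (sideBound s (t ∷ i₃ ∷ a ∷ i ∷ []) distinct))

  answer : ∀ s i x → Legal empty (vertexAt s i) x → BobWinsB (place ((vertexAt s i , x) ∷ []))
  answer s i x opening with x ≟ 0 | x ≟ m | x + x ≟ m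
  -- x = 0: Bob puts m on the same side.
  ... | yes refl | _ | _ =
        bobKills response (dead-sameSide _ s {i} {other s i} (keepOpening response)
                                         (update-same _ (vertexAt s (other s i)) m))
    where
    response : Legal (place ((vertexAt s i , 0) ∷ [])) (vertexAt s (other s i)) m
    response = secondMove-legal opening (other≢ s i) ≤-refl (<⇒≢ 1≤m)
  -- x = m: Bob puts 0 on the same side.
  ... | no _ | yes refl | _ =
        bobKills response (dead-sameSide _ s {other s i} {i} (update-same _ (vertexAt s (other s i)) 0)
                                         (keepOpening response))
    where
    response : Legal (place ((vertexAt s i , m) ∷ [])) (vertexAt s (other s i)) 0
    response = secondMove-legal opening (other≢ s i) z≤n (>⇒≢ 1≤m)
  -- x ≠ m/2: Bob puts m − x on the other side.
  ... | no x≢0 | no x≢m | no x+x≢m =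
        bobKills response (dead-complementary _ s {i} {first (not s)} (keepOpening response)
                          (update-same _ (vertexAt (not s) (first (not s))) (m ∸ x))
                          (m+[n∸m]≡n x≤m) x≢0 (m>n⇒m∸n≢0 (≤∧≢⇒< x≤m x≢m)))
    where
    x≤m : x ≤ m
    x≤m = legal-bound opening
    response : Legal (place ((vertexAt s i , x) ∷ [])) (vertexAt (not s) (first (not s))) (m ∸ x)
    response = secondMove-legal opening (λ e → vertexAt-opposite s (sym e)) (m∸n≤m m x)
                             (λ e → x+x≢m (trans (cong (_+ x) e) (m∸n+n≡m x≤m)))
  -- x = m/2: Bob puts 1 on the same side; then the side is full, or the threat applies.
  ... | no x≢0 | no x≢m | yes x+x≡m = bobMoves response continue
    where
    a : Fin (size s)
    a = other s i
    ps : List (V × ℕ)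
    ps = (vertexAt s a , 1) ∷ (vertexAt s i , x) ∷ []
    response : Legal (place ((vertexAt s i , x) ∷ [])) (vertexAt s a) 1
    response = secondMove-legal opening (other≢ s i) 1≤m
                             (λ e → >⇒≢ (≤-trans (s≤s (s≤s (s≤s z≤n))) 4≤m) (trans (sym x+x≡m) (cong (λ y → y + y) e)))
    continue : BobWinsA (place ps)
    continue with side-full? (place ps) s
    ... | inj₁ full = dead⇒BobWinsA (proj₂ response) (dead-fullPlacement ps s (((λ ()) , 1≢m) ∷ (x≢0 , x≢m) ∷ []) full)
    ... | inj₂ (t , ft) = halfThreat s i x (half-≥3 x (subst (6 ≤_) (sym x+x≡m) (sideBound s (t ∷ a ∷ i ∷ []) distinct)))
                                     x+x≡m response
      where
      distinct : AllPairs _≢_ (t ∷ a ∷ i ∷ [])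
      distinct = (free≢labelledAt {place ps} {s} {t} {a} ft (update-same _ (vertexAt s a) 1)
                  ∷ free≢labelledAt {place ps} {s} {t} {i} ft (keepOpening response) ∷ [])
               ∷ ((λ e → other≢ s i (cong (vertexAt s) e)) ∷ []) ∷ [] ∷ []

  aliceFirst : BobWinsAliceFirst (K p q)
  aliceFirst = reply (freeVertex-incomplete (inj₁ (first true)) refl) λ where
    (inj₁ i) x opening → answer true i x opening
    (inj₂ j) x opening → answer false j x opening

  -- Bob opens with 1; the threat applies with n = m − 1.
  bobFirst : BobWinsBobFirst (K p q)
  bobFirst = bobMoves opening
    (Threat.bobWins true n (m+[n∸m]≡n 1≤m) 3≤n ps (proj₂ opening) (refl ∷ []) (fa ∷ []) a fa
      (((λ ()) , 1≢m) ∷ []) (<⇒≢ (≤-trans (s≤s (s≤s z≤n)) 3≤n) ∷ []) ([] ∷ [])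
      (λ { z≤ (z≢1 ∷ []) → ∣n-z∣≢∣n-1∣ 3≤n z≢1 z≤ ∷ [] })
      (λ { z≤ z≢n (z≢1 ∷ []) → (∣n-1∣≢∣1-z∣ 3≤n z≢n ∷ []) ∷ [] })
      two)
    where
    n : ℕ
    n = m ∸ 1
    3≤n : 3 ≤ n
    3≤n = ∸-monoˡ-≤ 1 4≤m
    a : Fin p
    a = first true
    ps : List (V × ℕ)
    ps = (inj₁ a , 1) ∷ []
    opening : Legal empty (inj₁ a) 1
    opening = legal-place [] (inj₁ a) 1 valid-empty refl 1≤m [] (λ { (_ , _) _ () }) []
    fa : place ps (inj₁ a) ≡ just 1
    fa = update-same empty (inj₁ a) 1
    -- a third vertex on side s forces m ≥ 6, i.e. n ≥ 5
    two : ∀ {i₃ t} → i₃ ≢ t → place ps (inj₁ i₃) ≡ nothing → place ps (inj₁ t) ≡ nothing →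
          TwoAnswerable n ps
    two {i₃} {t} i₃≢t fi₃ ft =
      ((λ ()) , ∣2-n∣≢∣2-1∣ (≤-trans (n≤1+n 4) (∸-monoˡ-≤ 1 (sideBound true (t ∷ i₃ ∷ a ∷ []) distinct)))) ∷ [] ,
      [] ∷ []
      where
      distinct : AllPairs _≢_ (t ∷ i₃ ∷ a ∷ [])
      distinct = ((λ e → i₃≢t (sym e)) ∷ free≢labelledAt {place ps} {true} {t} {a} ft fa ∷ [])
               ∷ (free≢labelledAt {place ps} {true} {i₃} {a} fi₃ fa ∷ []) ∷ [] ∷ []

theorem4 : ((p q : ℕ) → 2 ≤ p → 2 ≤ q → BobWinsAliceFirst (K p q) × BobWinsBobFirst (K p q))
           × ((q : ℕ) → 1 ≤ q → AliceWinsFirst (K 1 q))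
theorem4 = (λ p q 2≤p 2≤q → BobWins.aliceFirst p q 2≤p 2≤q , BobWins.bobFirst p q 2≤p 2≤q)
         , (λ q _ → Star.aliceWins q)
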